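{- Let $n\geq 2$ and $1\leq d\leq n-1$. The map $\det^{\wedge 1}_{d,n-d}$ is nonzero (hence injective) on the irreducible submodule of type $S_{2,1^{n-d-1}}A\otimes S_{1^{n-d+1}}B$ of its domain $\bigwedge^{n-d}A\otimes\bigwedge^{n-d}B\otimes(A\otimes B)$, and likewise on the irreducible submodule of type $S_{1^{n-d+1}}A\otimes S_{2,1^{n-d-1}}B$; in particular its image contains submodules isomorphic to each of these.
   Context: Let $A,B$ be $n$-dimensional complex vector spaces with bases $a_1,\dots,a_n$ and $b_1,\dots,b_n$, and set $X^i_j=a_i\otimes b_j\in A\otimes B$, viewed as the entries of a generic $n\times n$ matrix. For $I,J\subset[n]$ with $|I|=|J|=m$, let $\Delta^I_J\in S^m(A\otimes B)$ be the $m\times m$ minor of $(X^i_j)$ on rows $I$ and columns $J$. The span of the $m\times m$ minors is identified with $\bigwedge^mA\otimes\bigwedge^mB$ via $\Delta^I_J\leftrightarrow a_I\otimes b_J$. With $k=n-d$, the linear map $\det^{\wedge 1}_{d,n-d}:\bigwedge^{k}A\otimes\bigwedge^{k}B\otimes(A\otimes B)\to\bigwedge^{k-1}A\otimes\bigwedge^{k-1}B\otimes\bigwedge^{2}(A\otimes B)$ is defined by $\Delta^I_J\otimes v\mapsto\sum_{i\in I,\,j\in J}X^i_j\wedge v\otimes\frac{\partial\Delta^I_J}{\partial X^i_j}$, where $\frac{\partial\Delta^I_J}{\partial X^i_j}=\pm\Delta^{I\smallsetminus\{i\}}_{J\smallsetminus\{j\}}$ is the signed cofactor. $S_\pi A$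 denotes the irreducible $GL(A)$-module indexed by the partition $\pi$ (zero if $\pi$ has more than $n$ parts), and $1^m$ denotes $m$ parts equal to $1$. -}

module Defs where

open import Data.Nat using (ℕ; zero; suc; _<_; _<ᵇ_)
open import Data.Bool using (Bool; true; false; if_then_else_; _∧_; _∨_; not)
open import Data.Fin using (Fin; toℕ)
open import Data.Fin.Properties using () renaming (_≟_ to _≟F_)
open import Data.Fin.Subset using (Subset; inside; outside; ∣_∣)
open import Data.Vec using (Vec; []; _∷_; lookup; _[_]≔_)
open import Data.Vec.Properties using (≡-dec)
open import Data.List using (List; []; _∷_; map; concatMap; foldr; allFin)
open import Data.Product using (_×_; _,_; ∃-syntax; Σ-syntax)
open import Data.Rational using (ℚ; 0ℚ; 1ℚ; -_; _+_; _*_)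
open import Relation.Binary.PropositionalEquality using (_≡_; _≢_)
open import Relation.Nullary.Decidable using (⌊_⌋)
import Data.Bool.Properties as BoolP

∑[_]_ : {X : Set} → List X → (X → ℚ) → ℚ
∑[ xs ] f = foldr (λ x acc → f x + acc) 0ℚ xs

sgn : ℕ → ℚ
sgn zero    = 1ℚ
sgn (suc m) = - sgn m

[_] : Bool → ℚ
[ true ]  = 1ℚ
[ false ] = 0ℚ

allSubsets : (n : ℕ) → List (Subset n)
allSubsets zero    = [] ∷ []
allSubsets (suc n) = concatMap (λ s → (inside ∷ s) ∷ (outside ∷ s) ∷ []) (allSubsets n)

_=S_ : {n : ℕ} → Subset n → Subset n → Bool
I =S J = ⌊ ≡-dec BoolP._≟_ I J ⌋

_=F_ : {n : ℕ} → Fin n → Fin n → Bool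
i =F j = ⌊ i ≟F j ⌋

_∈ᵇ_ : {n : ℕ} → Fin n → Subset n → Bool
i ∈ᵇ I = lookup I i

#below : {n : ℕ} → Subset n → Fin n → ℕ
#below {n} I i = foldr (λ j acc → if (j ∈ᵇ I) ∧ (toℕ j <ᵇ toℕ i) then suc acc else acc) 0 (allFin n)

#above : {n : ℕ} → Subset n → Fin n → ℕ
#above {n} I i = foldr (λ j acc → if (j ∈ᵇ I) ∧ (toℕ i <ᵇ toℕ j) then suc acc else acc) 0 (allFin n)

remove : {n : ℕ} → Subset n → Fin n → Subset n
remove I i = I [ i ]≔ outside

insert : {n : ℕ} → Subset n → Fin n → Subset n
insert I i = I [ i ]≔ inside

-- Vector spaces over ℚ, given by coefficient functions on bases.
--
-- Basis of A ⊗ B : X^i_j = a_i ⊗ b_j, indexed by (i , j) ∈ Fin n × Fin n.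
-- Basis of ⋀A (all degrees) : a_I, I a subset of Fin n (elements in increasing order).
-- Basis of ⋀²(A⊗B) : X^p ∧ X^q with p < q in the lexicographic order on Fin n × Fin n.

Entry : ℕ → Set
Entry n = Fin n × Fin n

_<E_ : {n : ℕ} → Entry n → Entry n → Bool
(i , j) <E (i' , j') = (toℕ i <ᵇ toℕ i') ∨ ((i =F i') ∧ (toℕ j <ᵇ toℕ j'))

_=E_ : {n : ℕ} → Entry n → Entry n → Bool
(i , j) =E (i' , j') = (i =F i') ∧ (j =F j')

-- coefficient of the basis vector X^p ∧ X^q (p < q) in X^x ∧ X^y
wedgeCoeff : {n : ℕ} → Entry n → Entry n → Entry n → Entry n → ℚ
wedgeCoeff x y p q =
  [ p <E q ] * ([ (x =E p) ∧ (y =E q) ] + - [ (x =E q) ∧ (y =E p) ])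

-- Domain  ⋀^• A ⊗ ⋀^• B ⊗ (A ⊗ B) : basis  Δ^I_J ⊗ X^i_j  ↔  (I , J , (i , j))
Dom : ℕ → Set
Dom n = Subset n × Subset n × Entry n → ℚ

-- Codomain  ⋀^• A ⊗ ⋀^• B ⊗ ⋀²(A⊗B) : basis (I , J , p , q), only p < q used
Cod : ℕ → Set
Cod n = Subset n × Subset n × Entry n × Entry n → ℚ

-- signed cofactor: ∂Δ^I_J / ∂X^i_j = (-1)^(pos_I(i) + pos_J(j)) Δ^{I∖i}_{J∖j}
-- (for i ∈ I, j ∈ J; pos = number of smaller elements)
cofSign : {n : ℕ} → Subset n → Subset n → Entry n → ℚ
cofSign I J (i , j) = sgn (#below I i) * sgn (#below J j)

-- image of the basis vector Δ^I_J ⊗ X^v under det^{∧1}: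
--   Σ_{i∈I, j∈J} (X^i_j ∧ X^v) ⊗ ∂Δ^I_J/∂X^i_j ,   read off at (I' , J' , p , q)
detWedgeBasis : {n : ℕ} → Subset n → Subset n → Entry n → Cod n
detWedgeBasis {n} I J v (I' , J' , p , q) =
  ∑[ allFin n ] λ i → ∑[ allFin n ] λ j →
    [ (i ∈ᵇ I) ∧ (j ∈ᵇ J) ∧ (I' =S remove I i) ∧ (J' =S remove J j) ]
    * cofSign I J (i , j) * wedgeCoeff (i , j) v p q

-- the linear map det^{∧1} (extended linearly; on degree (k,k) it is det^{∧1}_{d,n-d})
detWedge : {n : ℕ} → Dom n → Cod n
detWedge {n} x c =
  ∑[ allSubsets n ] λ I → ∑[ allSubsets n ] λ J →
  ∑[ allFin n ] λ i → ∑[ allFin n ] λ j →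
    x (I , J , (i , j)) * detWedgeBasis I J (i , j) c

HasDegree : {n : ℕ} → ℕ → Dom n → Set
HasDegree {n} k x = ∀ I J e → x (I , J , e) ≢ 0ℚ → (∣ I ∣ ≡ k) × (∣ J ∣ ≡ k)

-- Pieri pieces of ⋀^k V ⊗ V  (V = A or B, basis index Fin n):
--   ⋀^k V ⊗ V = S_{2,1^{k-1}} V ⊕ ⋀^{k+1} V,
-- S_{2,1^{k-1}} V = kernel of the multiplication  v_I ⊗ v_i ↦ v_I ∧ v_i ,
-- ⋀^{k+1} V = image of the comultiplication  v_K ↦ Σ_{j∈K} v_{K∖j} ⊗ v_j ∧-signed.

-- coefficient of v_K in v_I ∧ v_i
mulCoeff : {n : ℕ} → Subset n → Fin n → Subset n → ℚ
mulCoeff I i K = [ not (i ∈ᵇ I) ∧ (K =S insert I i) ] * sgn (#above I i)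

-- coefficient of v_J ⊗ v_j in the comultiplication of v_K
-- (v_K = (-1)^{#above} v_{K∖j} ∧ v_j, so this is the GL-equivariant inverse up to scalar)
comulCoeff : {n : ℕ} → Subset n → Subset n → Fin n → ℚ
comulCoeff K J j = [ (j ∈ᵇ K) ∧ (J =S remove K j) ] * sgn (#above K j)

-- x ∈ S_{2,1^{k-1}}A ⊗ (⋀^k B ⊗ B): killed by the multiplication on the A-factor
InKerMulA : {n : ℕ} → Dom n → Set
InKerMulA {n} x = ∀ K J j →
  (∑[ allSubsets n ] λ I → ∑[ allFin n ] λ i → x (I , J , (i , j)) * mulCoeff I i K) ≡ 0ℚ

InKerMulB : {n : ℕ} → Dom n → Set
InKerMulB {n} x = ∀ I i K →
  (∑[ allSubsets n ] λ J → ∑[ allFin n ] λ j → x (I , J , (i , j)) * mulCoeff J j K) ≡ 0ℚ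

-- x ∈ (⋀^k A ⊗ A) ⊗ ⋀^{k+1}B : image of the comultiplication on the B-factor
InImComulB : {n : ℕ} → Dom n → Set
InImComulB {n} x = Σ[ w ∈ (Subset n → Fin n → Subset n → ℚ) ] (∀ I J i j →
  x (I , J , (i , j)) ≡ (∑[ allSubsets n ] λ K → w I i K * comulCoeff K J j))

InImComulA : {n : ℕ} → Dom n → Set
InImComulA {n} x = Σ[ w ∈ (Subset n → Fin n → Subset n → ℚ) ] (∀ I J i j →
  x (I , J , (i , j)) ≡ (∑[ allSubsets n ] λ K → w J j K * comulCoeff K I i))

-- the irreducible submodule  S_{2,1^{k-1}}A ⊗ S_{1^{k+1}}B  of  ⋀^kA⊗⋀^kB⊗(A⊗B)
InS21A⊗ΛB : {n : ℕ} → ℕ → Dom n → Set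
InS21A⊗ΛB k x = HasDegree k x × InKerMulA x × InImComulB x

-- the irreducible submodule  S_{1^{k+1}}A ⊗ S_{2,1^{k-1}}B
InΛA⊗S21B : {n : ℕ} → ℕ → Dom n → Set
InΛA⊗S21B k x = HasDegree k x × InImComulA x × InKerMulB x

NonZeroCod : {n : ℕ} → Cod n → Set
NonZeroCod y = ∃[ c ] (y c ≢ 0ℚ)

{-# OPTIONS --safe #-}
-- Write k = n - d and take F ⊆ {2, …, n-1} with |F| = k - 1, I₀ = {0} ∪ F and K₀ = {0,1} ∪ F.
-- The witness is x₀ = a_{I₀} ⊗ a₀ ⊗ Δ(b_{K₀}), with Δ : ⋀^{k+1}B → ⋀^k B ⊗ B the comultiplication;
-- it lies in S_{2,1^{k-1}}A ⊗ ⋀^{k+1}B because a₀ already occurs in a_{I₀}. Its image has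
-- coefficient ±2 on Δ^F_F ⊗ X⁰₀ ∧ X⁰₁: only the terms b_{K₀∖j} ⊗ b_j with j = 0, 1 contribute,
-- each through the cofactor of the other entry of row 0, and the sign change of Δ between them is
-- cancelled by the antisymmetry of the wedge. Transposing the matrix exchanges the two submodules
-- and commutes with det^{∧1} at every coordinate X^p ∧ X^q whose entries keep their lexicographic
-- order after transposition; this gives the second half.

module Submission where

open import Defs
open import Algebra.Bundles using (CommutativeMonoid)
open import Data.Bool using (Bool; true; false; T; _∧_; _∨_; not; if_then_else_)
open import Data.Bool.Properties using (_≟_; ∧-comm; ∧-zeroʳ; ∧-conicalˡ; ∧-conicalʳ)
open import Data.Empty using (⊥-elim)
open import Data.Fin using (Fin; zero; suc; toℕ)
import Data.Fin.Properties as Fin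
open import Data.Fin.Subset using (Subset; inside; outside; ⊥; ∣_∣)
open import Data.Fin.Subset.Properties using (∣⊥∣≡0)
open import Data.List using (List; []; _∷_; allFin; tabulate; concatMap; foldr)
open import Data.Nat using (ℕ; zero; suc; _≤_; _∸_; _<ᵇ_; z≤n; s≤s)
import Data.Nat.Properties as ℕ
open import Data.Product using (_×_; _,_; Σ-syntax; proj₁; proj₂; swap)
open import Data.Rational using (ℚ; 0ℚ; 1ℚ; -_; _+_; _*_)
import Data.Rational.Properties as ℚ
open import Data.Sum using (_⊎_; inj₁; inj₂)
open import Data.Vec using ([]; _∷_; tail)
open import Data.Vec.Properties using (≡-dec)
open import Function using (_∘_)
open import Relation.Binary.PropositionalEquality hiding ([_])
open import Relation.Nullary using (Dec; ¬_; yes; no)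
open import Relation.Nullary.Decidable using (⌊_⌋; isYes≗does; dec-true; dec-false; toWitness)
open import Algebra.Properties.CommutativeSemigroup
  (CommutativeMonoid.commutativeSemigroup ℚ.+-0-commutativeMonoid) using (interchange)

open ≡-Reasoning

∑-cong : {X : Set} (xs : List X) {f g : X → ℚ} → (∀ x → f x ≡ g x) → ∑[ xs ] f ≡ ∑[ xs ] g
∑-cong []       f≗g = refl
∑-cong (x ∷ xs) f≗g = cong₂ _+_ (f≗g x) (∑-cong xs f≗g)

∑-zero : {X : Set} (xs : List X) {f : X → ℚ} → (∀ x → f x ≡ 0ℚ) → ∑[ xs ] f ≡ 0ℚ
∑-zero []       f≗0 = refl
∑-zero (x ∷ xs) f≗0 = trans (cong₂ _+_ (f≗0 x) (∑-zero xs f≗0)) (ℚ.+-identityʳ 0ℚ)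

∑-+ : {X : Set} (xs : List X) (f g : X → ℚ) → ∑[ xs ] (λ x → f x + g x) ≡ ∑[ xs ] f + ∑[ xs ] g
∑-+ []       f g = refl
∑-+ (x ∷ xs) f g = trans (cong (f x + g x +_) (∑-+ xs f g)) (interchange (f x) (g x) _ _)

∑-swap : {X Y : Set} (xs : List X) (ys : List Y) (f : X → Y → ℚ) →
  ∑[ xs ] (λ x → ∑[ ys ] (f x)) ≡ ∑[ ys ] (λ y → ∑[ xs ] (λ x → f x y))
∑-swap []       ys f = sym (∑-zero ys (λ _ → refl))
∑-swap (x ∷ xs) ys f = trans (cong (∑[ ys ] (f x) +_) (∑-swap xs ys f))
  (sym (∑-+ ys (f x) (λ y → ∑[ xs ] (λ x′ → f x′ y))))

∑-tabulate : {X : Set} (n : ℕ) (g : Fin n → X) (f : X → ℚ) →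
  ∑[ tabulate g ] f ≡ ∑[ allFin n ] (f ∘ g)
∑-tabulate zero    g f = refl
∑-tabulate (suc n) g f =
  cong (f (g zero) +_) (trans (∑-tabulate n (g ∘ suc) f) (sym (∑-tabulate n suc (f ∘ g))))

∑-allFin-single : ∀ {n} (i₀ : Fin n) {f : Fin n → ℚ} → (∀ i → i ≢ i₀ → f i ≡ 0ℚ) →
  ∑[ allFin n ] f ≡ f i₀
∑-allFin-single {suc n} zero {f} f≗0 = begin
  f zero + ∑[ tabulate suc ] f     ≡⟨ cong (f zero +_) (∑-tabulate n suc f) ⟩
  f zero + ∑[ allFin n ] (f ∘ suc) ≡⟨ cong (f zero +_) (∑-zero (allFin n) (λ i → f≗0 (suc i) λ ())) ⟩
  f zero + 0ℚ                      ≡⟨ ℚ.+-identityʳ (f zero) ⟩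
  f zero                           ∎
∑-allFin-single {suc n} (suc i₀) {f} f≗0 = begin
  f zero + ∑[ tabulate suc ] f ≡⟨ cong₂ _+_ (f≗0 zero λ ()) (∑-tabulate n suc f) ⟩
  0ℚ + ∑[ allFin n ] (f ∘ suc) ≡⟨ ℚ.+-identityˡ _ ⟩
  ∑[ allFin n ] (f ∘ suc)      ≡⟨ ∑-allFin-single i₀ (λ i i≢i₀ → f≗0 (suc i) (i≢i₀ ∘ Fin.suc-injective)) ⟩
  f (suc i₀)                   ∎

∑-concatMap-pair : {X Y : Set} (xs : List X) (a b : X → Y) (f : Y → ℚ) →
  ∑[ concatMap (λ x → a x ∷ b x ∷ []) xs ] f ≡ ∑[ xs ] (λ x → f (a x) + f (b x))
∑-concatMap-pair []       a b f = refl
∑-concatMap-pair (x ∷ xs) a b f =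
  trans (cong (λ r → f (a x) + (f (b x) + r)) (∑-concatMap-pair xs a b f))
        (sym (ℚ.+-assoc (f (a x)) (f (b x)) _))

∑-allSubsets-single : ∀ {n} (K₀ : Subset n) {f : Subset n → ℚ} → (∀ K → K ≢ K₀ → f K ≡ 0ℚ) →
  ∑[ allSubsets n ] f ≡ f K₀
∑-allSubsets-single {zero}  []       {f} f≗0 = ℚ.+-identityʳ (f [])
∑-allSubsets-single {suc n} (b ∷ K₀) {f} f≗0 = begin
  ∑[ allSubsets (suc n) ] f
    ≡⟨ ∑-concatMap-pair (allSubsets n) (inside ∷_) (outside ∷_) f ⟩
  ∑[ allSubsets n ] (λ K → f (inside ∷ K) + f (outside ∷ K))
    ≡⟨ ∑-allSubsets-single K₀ off-K₀ ⟩
  f (inside ∷ K₀) + f (outside ∷ K₀)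
    ≡⟨ at-K₀ b f≗0 ⟩
  f (b ∷ K₀) ∎
  where
  off-K₀ : ∀ K → K ≢ K₀ → f (inside ∷ K) + f (outside ∷ K) ≡ 0ℚ
  off-K₀ K K≢K₀ =
    trans (cong₂ _+_ (f≗0 _ (K≢K₀ ∘ cong tail)) (f≗0 _ (K≢K₀ ∘ cong tail))) (ℚ.+-identityʳ 0ℚ)
  at-K₀ : ∀ b → (∀ K → K ≢ b ∷ K₀ → f K ≡ 0ℚ) → f (inside ∷ K₀) + f (outside ∷ K₀) ≡ f (b ∷ K₀)
  at-K₀ true  vanish = trans (cong (f (inside ∷ K₀) +_) (vanish _ λ ())) (ℚ.+-identityʳ _)
  at-K₀ false vanish = trans (cong (_+ f (outside ∷ K₀)) (vanish _ λ ())) (ℚ.+-identityˡ _)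

∑-allEntries-single : ∀ {n} (e₀ : Entry n) {f : Entry n → ℚ} → (∀ e → e ≢ e₀ → f e ≡ 0ℚ) →
  ∑[ allFin n ] (λ a → ∑[ allFin n ] (λ b → f (a , b))) ≡ f e₀
∑-allEntries-single {n} (a₀ , b₀) f≗0 =
  trans (∑-allFin-single a₀ (λ a a≢a₀ → ∑-zero (allFin n) (λ b → f≗0 (a , b) (a≢a₀ ∘ cong proj₁))))
        (∑-allFin-single b₀ (λ b b≢b₀ → f≗0 (a₀ , b) (b≢b₀ ∘ cong proj₂)))

module _ {A : Set} (a? : Dec A) where

  ⌊⌋-true : A → ⌊ a? ⌋ ≡ true
  ⌊⌋-true a = trans (isYes≗does a?) (dec-true a? a)

  ⌊⌋-false : ¬ A → ⌊ a? ⌋ ≡ false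
  ⌊⌋-false ¬a = trans (isYes≗does a?) (dec-false a? ¬a)

  ⌊⌋-sound : ⌊ a? ⌋ ≡ true → A
  ⌊⌋-sound eq = toWitness (subst T (sym eq) _)

module _ {n : ℕ} where

  =S-refl : (I : Subset n) → (I =S I) ≡ true
  =S-refl I = ⌊⌋-true (≡-dec _≟_ I I) refl

  =S-≢ : {I J : Subset n} → I ≢ J → (I =S J) ≡ false
  =S-≢ {I} {J} = ⌊⌋-false (≡-dec _≟_ I J)

  =S-sound : {I J : Subset n} → (I =S J) ≡ true → I ≡ J
  =S-sound {I} {J} = ⌊⌋-sound (≡-dec _≟_ I J)

  =F-refl : (i : Fin n) → (i =F i) ≡ true
  =F-refl i = ⌊⌋-true (i Fin.≟ i) refl

  =F-≢ : {i j : Fin n} → i ≢ j → (i =F j) ≡ false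
  =F-≢ {i} {j} = ⌊⌋-false (i Fin.≟ j)

  =F-sound : {i j : Fin n} → (i =F j) ≡ true → i ≡ j
  =F-sound {i} {j} = ⌊⌋-sound (i Fin.≟ j)

  =E-refl : (e : Entry n) → (e =E e) ≡ true
  =E-refl (i , j) = cong₂ _∧_ (=F-refl i) (=F-refl j)

  =E-sound : {e e′ : Entry n} → (e =E e′) ≡ true → e ≡ e′
  =E-sound {i , j} {i′ , j′} eq =
    cong₂ _,_ (=F-sound (∧-conicalˡ _ _ eq)) (=F-sound (∧-conicalʳ (i =F i′) _ eq))

  =E-≢ : {e e′ : Entry n} → e ≢ e′ → (e =E e′) ≡ false
  =E-≢ {e} {e′} e≢e′ with e =E e′ in eq
  ... | true  = ⊥-elim (e≢e′ (=E-sound eq))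
  ... | false = refl

tally : {X : Set} → (X → Bool) → List X → ℕ
tally P = foldr (λ x acc → if P x then suc acc else acc) 0

tally-none : {X : Set} (P : X → Bool) (xs : List X) → (∀ x → P x ≡ false) → tally P xs ≡ 0
tally-none P []       P≗false = refl
tally-none P (x ∷ xs) P≗false rewrite P≗false x = tally-none P xs P≗false

tally-tabulate-cong : {X : Set} (n : ℕ) (g : Fin n → X) (P Q : X → Bool) →
  (∀ i → P (g i) ≡ Q (g i)) → tally P (tabulate g) ≡ tally Q (tabulate g)
tally-tabulate-cong zero    g P Q P≗Q = refl
tally-tabulate-cong (suc n) g P Q P≗Q rewrite P≗Q zero =
  cong (λ c → if Q (g zero) then suc c else c) (tally-tabulate-cong n (g ∘ suc) P Q (P≗Q ∘ suc))

#below-zero : ∀ {n} (I : Subset (suc n)) → #below I zero ≡ 0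
#below-zero I = tally-none _ (allFin _) (λ j → ∧-zeroʳ (j ∈ᵇ I))

#below-outside-one : ∀ {n} (K : Subset (suc n)) → #below (outside ∷ K) (suc zero) ≡ 0
#below-outside-one K = tally-none _ (allFin _) below-one
  where
  below-one : ∀ j → ((j ∈ᵇ (outside ∷ K)) ∧ (toℕ j <ᵇ 1)) ≡ false
  below-one zero    = refl
  below-one (suc j) = ∧-zeroʳ (j ∈ᵇ K)

#above-inside-zero : ∀ {n} (K : Subset n) →
  #above (inside ∷ inside ∷ K) zero ≡ suc (#above (inside ∷ inside ∷ K) (suc zero))
#above-inside-zero {n} K = cong suc (tally-tabulate-cong n (λ i → suc (suc i))
  (λ j → (j ∈ᵇ (inside ∷ inside ∷ K)) ∧ (0 <ᵇ toℕ j))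
  (λ j → (j ∈ᵇ (inside ∷ inside ∷ K)) ∧ (1 <ᵇ toℕ j)) (λ i → refl))

remove-size : ∀ {n} (K : Subset n) (j : Fin n) → j ∈ᵇ K ≡ true → suc ∣ remove K j ∣ ≡ ∣ K ∣
remove-size (true  ∷ K) zero    refl = refl
remove-size (true  ∷ K) (suc j) j∈K  = cong suc (remove-size K j j∈K)
remove-size (false ∷ K) (suc j) j∈K  = remove-size K j j∈K

initialSegment : (m k : ℕ) → Subset m
initialSegment zero    k       = []
initialSegment (suc m) zero    = ⊥
initialSegment (suc m) (suc k) = inside ∷ initialSegment m k

∣initialSegment∣ : ∀ {m k} → k ≤ m → ∣ initialSegment m k ∣ ≡ k
∣initialSegment∣ {zero}  z≤n       = refl
∣initialSegment∣ {suc m} z≤n       = ∣⊥∣≡0 (suc m)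
∣initialSegment∣ {suc m} (s≤s k≤m) = cong suc (∣initialSegment∣ k≤m)

[]-support : ∀ b → [ b ] ≢ 0ℚ → b ≡ true
[]-support true  _    = refl
[]-support false [b]≢0 = ⊥-elim ([b]≢0 refl)

*-nonzeroˡ : ∀ x y → x * y ≢ 0ℚ → x ≢ 0ℚ
*-nonzeroˡ x y xy≢0 x≡0 = xy≢0 (trans (cong (_* y) x≡0) (ℚ.*-zeroˡ y))

*-nonzeroʳ : ∀ x y → x * y ≢ 0ℚ → y ≢ 0ℚ
*-nonzeroʳ x y xy≢0 y≡0 = xy≢0 (trans (cong (x *_) y≡0) (ℚ.*-zeroʳ x))

Λ⊗V : ℕ → Set
Λ⊗V n = Subset n → Fin n → ℚ

basis : ∀ {n} → Subset n → Fin n → Λ⊗V n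
basis I₀ i₀ I i = [ (I =S I₀) ∧ (i =F i₀) ]

_⊠_ : ∀ {n} → Λ⊗V n → Λ⊗V n → Dom n
(f ⊠ g) (I , J , (i , j)) = f I i * g J j

module _ {n : ℕ} (I₀ : Subset n) (i₀ : Fin n) where

  basis-self : basis I₀ i₀ I₀ i₀ ≡ 1ℚ
  basis-self = cong [_] (cong₂ _∧_ (=S-refl I₀) (=F-refl i₀))

  basis-≢ˡ : ∀ {I} i → I ≢ I₀ → basis I₀ i₀ I i ≡ 0ℚ
  basis-≢ˡ i I≢I₀ = cong (λ b → [ b ∧ (i =F i₀) ]) (=S-≢ I≢I₀)

  basis-≢ʳ : ∀ I {i} → i ≢ i₀ → basis I₀ i₀ I i ≡ 0ℚ
  basis-≢ʳ I i≢i₀ = cong [_] (trans (cong ((I =S I₀) ∧_) (=F-≢ i≢i₀)) (∧-zeroʳ _))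

  basis-support : ∀ {I i} → basis I₀ i₀ I i ≢ 0ℚ → I ≡ I₀ × i ≡ i₀
  basis-support {I} {i} ne =
    =S-sound (∧-conicalˡ _ _ both) , =F-sound (∧-conicalʳ (I =S I₀) _ both)
    where both = []-support _ ne

mulCoeff-∈ : ∀ {n} (I : Subset n) (i : Fin n) (K : Subset n) → i ∈ᵇ I ≡ true → mulCoeff I i K ≡ 0ℚ
mulCoeff-∈ I i K i∈I =
  trans (cong (λ b → [ not b ∧ (K =S insert I i) ] * sgn (#above I i)) i∈I)
        (ℚ.*-zeroˡ (sgn (#above I i)))

comulCoeff-remove : ∀ {n} (K : Subset n) (j : Fin n) → j ∈ᵇ K ≡ true →
  comulCoeff K (remove K j) j ≡ sgn (#above K j)
comulCoeff-remove K j j∈K =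
  trans (cong (λ b → [ b ] * sgn (#above K j)) (cong₂ _∧_ j∈K (=S-refl (remove K j))))
        (ℚ.*-identityˡ (sgn (#above K j)))

comulCoeff-≢ : ∀ {n} (K J : Subset n) (j : Fin n) → J ≢ remove K j → comulCoeff K J j ≡ 0ℚ
comulCoeff-≢ K J j J≢ =
  trans (cong (λ b → [ b ] * sgn (#above K j)) (trans (cong ((j ∈ᵇ K) ∧_) (=S-≢ J≢)) (∧-zeroʳ _)))
        (ℚ.*-zeroˡ (sgn (#above K j)))

comulCoeff-degree : ∀ {n} (K J : Subset n) (j : Fin n) → comulCoeff K J j ≢ 0ℚ → suc ∣ J ∣ ≡ ∣ K ∣
comulCoeff-degree K J j ne =
  trans (cong (suc ∘ ∣_∣) (=S-sound (∧-conicalʳ (j ∈ᵇ K) _ both)))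
        (remove-size K j (∧-conicalˡ _ _ both))
  where both = []-support _ (*-nonzeroˡ _ _ ne)

⊠-hasDegree : ∀ {n} k (f g : Λ⊗V n) →
  (∀ I i → f I i ≢ 0ℚ → ∣ I ∣ ≡ k) → (∀ J j → g J j ≢ 0ℚ → ∣ J ∣ ≡ k) → HasDegree k (f ⊠ g)
⊠-hasDegree k f g degf degg I J (i , j) ne =
  degf I i (*-nonzeroˡ (f I i) (g J j) ne) , degg J j (*-nonzeroʳ (f I i) (g J j) ne)

⊠-inKerMulA : ∀ {n} (f g : Λ⊗V n) → (∀ I i → f I i ≢ 0ℚ → i ∈ᵇ I ≡ true) → InKerMulA (f ⊠ g)
⊠-inKerMulA {n} f g supp K J j =
  ∑-zero (allSubsets n) λ I → ∑-zero (allFin n) λ i → term I i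
  where
  term : ∀ I i → (f I i * g J j) * mulCoeff I i K ≡ 0ℚ
  term I i with f I i ℚ.≟ 0ℚ
  ... | yes fIi≡0 = begin
    (f I i * g J j) * mulCoeff I i K ≡⟨ cong (λ z → (z * g J j) * mulCoeff I i K) fIi≡0 ⟩
    (0ℚ * g J j) * mulCoeff I i K    ≡⟨ cong (_* mulCoeff I i K) (ℚ.*-zeroˡ (g J j)) ⟩
    0ℚ * mulCoeff I i K              ≡⟨ ℚ.*-zeroˡ (mulCoeff I i K) ⟩
    0ℚ                               ∎
  ... | no  fIi≢0 = begin
    (f I i * g J j) * mulCoeff I i K ≡⟨ cong (f I i * g J j *_) (mulCoeff-∈ I i K (supp I i fIi≢0)) ⟩
    (f I i * g J j) * 0ℚ             ≡⟨ ℚ.*-zeroʳ (f I i * g J j) ⟩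
    0ℚ                               ∎

⊠comulCoeff-inImComulB : ∀ {n} (f : Λ⊗V n) (K₀ : Subset n) → InImComulB (f ⊠ comulCoeff K₀)
⊠comulCoeff-inImComulB {n} f K₀ = w , λ I J i j → sym (begin
  ∑[ allSubsets n ] (λ K → w I i K * comulCoeff K J j)
    ≡⟨ ∑-allSubsets-single K₀ (off-K₀ I J i j) ⟩
  (f I i * [ K₀ =S K₀ ]) * comulCoeff K₀ J j
    ≡⟨ cong (λ b → (f I i * [ b ]) * comulCoeff K₀ J j) (=S-refl K₀) ⟩
  (f I i * 1ℚ) * comulCoeff K₀ J j
    ≡⟨ cong (_* comulCoeff K₀ J j) (ℚ.*-identityʳ (f I i)) ⟩
  f I i * comulCoeff K₀ J j ∎)
  where
  w : Subset n → Fin n → Subset n → ℚ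
  w I i K = f I i * [ K =S K₀ ]
  off-K₀ : ∀ I J i j K → K ≢ K₀ → w I i K * comulCoeff K J j ≡ 0ℚ
  off-K₀ I J i j K K≢K₀ = begin
    (f I i * [ K =S K₀ ]) * comulCoeff K J j
      ≡⟨ cong (λ b → (f I i * [ b ]) * comulCoeff K J j) (=S-≢ K≢K₀) ⟩
    (f I i * 0ℚ) * comulCoeff K J j
      ≡⟨ cong (_* comulCoeff K J j) (ℚ.*-zeroʳ (f I i)) ⟩
    0ℚ * comulCoeff K J j
      ≡⟨ ℚ.*-zeroˡ (comulCoeff K J j) ⟩
    0ℚ ∎

Coord : ℕ → Set
Coord n = Subset n × Subset n × Entry n × Entry n

<ᵇ-irrefl : ∀ m → (m <ᵇ m) ≡ false
<ᵇ-irrefl zero    = refl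
<ᵇ-irrefl (suc m) = <ᵇ-irrefl m

<E-irrefl : ∀ {n} (e : Entry n) → (e <E e) ≡ false
<E-irrefl (i , j) =
  cong₂ _∨_ (<ᵇ-irrefl (toℕ i)) (trans (cong ((i =F i) ∧_) (<ᵇ-irrefl (toℕ j))) (∧-zeroʳ _))

<E⇒≢ : ∀ {n} (p q : Entry n) → (p <E q) ≡ true → p ≢ q
<E⇒≢ p q p<q refl with () ← trans (sym p<q) (<E-irrefl p)

module _ {n : ℕ} {p q : Entry n} (p<q : (p <E q) ≡ true) where

  wedgeCoeff-left : ∀ x → wedgeCoeff x p p q ≡ - [ x =E q ]
  wedgeCoeff-left x = evaluate (x =E p) (x =E q) p<q (=E-≢ (<E⇒≢ p q p<q)) (=E-refl p)
    where
    evaluate : ∀ b d {a c e} → a ≡ true → c ≡ false → e ≡ true →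
      [ a ] * ([ b ∧ c ] + - [ d ∧ e ]) ≡ - [ d ]
    evaluate false false refl refl refl = refl
    evaluate false true  refl refl refl = refl
    evaluate true  false refl refl refl = refl
    evaluate true  true  refl refl refl = refl

  wedgeCoeff-right : ∀ x → wedgeCoeff x q p q ≡ [ x =E p ]
  wedgeCoeff-right x = evaluate (x =E p) (x =E q) p<q (=E-refl q) (=E-≢ (≢-sym (<E⇒≢ p q p<q)))
    where
    evaluate : ∀ b d {a c e} → a ≡ true → c ≡ true → e ≡ false →
      [ a ] * ([ b ∧ c ] + - [ d ∧ e ]) ≡ [ b ]
    evaluate false false refl refl refl = refl
    evaluate false true  refl refl refl = refl
    evaluate true  false refl refl refl = refl
    evaluate true  true  refl refl refl = refl

wedgeCoeff-other : ∀ {n} (x v p q : Entry n) → (v =E q) ≡ false → (v =E p) ≡ false →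
  wedgeCoeff x v p q ≡ 0ℚ
wedgeCoeff-other x v p q v≢q v≢p = evaluate (p <E q) (x =E p) (x =E q) v≢q v≢p
  where
  evaluate : ∀ a b d {c e} → c ≡ false → e ≡ false → [ a ] * ([ b ∧ c ] + - [ d ∧ e ]) ≡ 0ℚ
  evaluate a false false refl refl = ℚ.*-zeroʳ [ a ]
  evaluate a false true  refl refl = ℚ.*-zeroʳ [ a ]
  evaluate a true  false refl refl = ℚ.*-zeroʳ [ a ]
  evaluate a true  true  refl refl = ℚ.*-zeroʳ [ a ]

cofactorCoeff : ∀ {n} → Subset n → Subset n → Subset n → Subset n → Entry n → ℚ
cofactorCoeff I J I′ J′ (a , b) =
  [ (a ∈ᵇ I) ∧ (b ∈ᵇ J) ∧ (I′ =S remove I a) ∧ (J′ =S remove J b) ] * cofSign I J (a , b)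

cofactorCoeff-remove : ∀ {n} (I J : Subset n) (a b : Fin n) → a ∈ᵇ I ≡ true → b ∈ᵇ J ≡ true →
  cofactorCoeff I J (remove I a) (remove J b) (a , b) ≡ cofSign I J (a , b)
cofactorCoeff-remove I J a b a∈I b∈J = trans
  (cong (λ t → [ t ] * cofSign I J (a , b))
        (cong₂ _∧_ a∈I (cong₂ _∧_ b∈J (cong₂ _∧_ (=S-refl (remove I a)) (=S-refl (remove J b))))))
  (ℚ.*-identityˡ (cofSign I J (a , b)))

module _ {n : ℕ} (I J I′ J′ : Subset n) where

  private
    C : Entry n → ℚ
    C = cofactorCoeff I J I′ J′

  detWedgeBasis-left : (p q : Entry n) → (p <E q) ≡ true →
    detWedgeBasis I J p (I′ , J′ , p , q) ≡ - C q
  detWedgeBasis-left p q p<q = begin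
    detWedgeBasis I J p (I′ , J′ , p , q)
      ≡⟨ ∑-allEntries-single q {λ e → C e * wedgeCoeff e p p q} off-q ⟩
    C q * wedgeCoeff q p p q
      ≡⟨ cong (C q *_) (trans (wedgeCoeff-left p<q q) (cong (λ b → - [ b ]) (=E-refl q))) ⟩
    C q * - 1ℚ
      ≡⟨ ℚ.neg-distribʳ-* (C q) 1ℚ ⟨
    - (C q * 1ℚ)
      ≡⟨ cong -_ (ℚ.*-identityʳ (C q)) ⟩
    - C q ∎
    where
    off-q : ∀ e → e ≢ q → C e * wedgeCoeff e p p q ≡ 0ℚ
    off-q e e≢q =
      trans (cong (C e *_) (trans (wedgeCoeff-left p<q e) (cong (λ b → - [ b ]) (=E-≢ e≢q))))
            (ℚ.*-zeroʳ (C e))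

  detWedgeBasis-right : (p q : Entry n) → (p <E q) ≡ true →
    detWedgeBasis I J q (I′ , J′ , p , q) ≡ C p
  detWedgeBasis-right p q p<q = begin
    detWedgeBasis I J q (I′ , J′ , p , q)
      ≡⟨ ∑-allEntries-single p {λ e → C e * wedgeCoeff e q p q} off-p ⟩
    C p * wedgeCoeff p q p q
      ≡⟨ cong (C p *_) (trans (wedgeCoeff-right p<q p) (cong [_] (=E-refl p))) ⟩
    C p * 1ℚ
      ≡⟨ ℚ.*-identityʳ (C p) ⟩
    C p ∎
    where
    off-p : ∀ e → e ≢ p → C e * wedgeCoeff e q p q ≡ 0ℚ
    off-p e e≢p =
      trans (cong (C e *_) (trans (wedgeCoeff-right p<q e) (cong [_] (=E-≢ e≢p))))
            (ℚ.*-zeroʳ (C e))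

  detWedgeBasis-other : (v p q : Entry n) → (v =E q) ≡ false → (v =E p) ≡ false →
    detWedgeBasis I J v (I′ , J′ , p , q) ≡ 0ℚ
  detWedgeBasis-other v p q v≢q v≢p = ∑-zero (allFin n) λ a → ∑-zero (allFin n) λ b →
    trans (cong (C (a , b) *_) (wedgeCoeff-other (a , b) v p q v≢q v≢p)) (ℚ.*-zeroʳ (C (a , b)))

detWedge-basis⊠ : ∀ {n} (I₀ : Subset n) (i₀ : Fin n) (g : Λ⊗V n) (c : Coord n) →
  detWedge (basis I₀ i₀ ⊠ g) c
    ≡ ∑[ allSubsets n ] λ J → ∑[ allFin n ] λ j → g J j * detWedgeBasis I₀ J (i₀ , j) c
detWedge-basis⊠ {n} I₀ i₀ g c = begin
  detWedge (basis I₀ i₀ ⊠ g) c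
    ≡⟨ ∑-allSubsets-single I₀ {λ I → ∑[ allSubsets n ] λ J → ∑[ allFin n ] λ i → ∑[ allFin n ] term I J i}
         (λ I I≢I₀ → ∑-zero (allSubsets n) λ J → ∑-zero (allFin n) λ i → ∑-zero (allFin n) λ j →
           vanishing I J i j (basis-≢ˡ I₀ i₀ i I≢I₀)) ⟩
  (∑[ allSubsets n ] λ J → ∑[ allFin n ] λ i → ∑[ allFin n ] term I₀ J i)
    ≡⟨ ∑-cong (allSubsets n) (λ J → ∑-allFin-single i₀ {λ i → ∑[ allFin n ] term I₀ J i} λ i i≢i₀ →
         ∑-zero (allFin n) λ j → vanishing I₀ J i j (basis-≢ʳ I₀ i₀ I₀ i≢i₀)) ⟩
  (∑[ allSubsets n ] λ J → ∑[ allFin n ] term I₀ J i₀)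
    ≡⟨ ∑-cong (allSubsets n) (λ J → ∑-cong (allFin n) λ j →
         cong (_* detWedgeBasis I₀ J (i₀ , j) c)
              (trans (cong (_* g J j) (basis-self I₀ i₀)) (ℚ.*-identityˡ (g J j)))) ⟩
  (∑[ allSubsets n ] λ J → ∑[ allFin n ] λ j → g J j * detWedgeBasis I₀ J (i₀ , j) c) ∎
  where
  term : Subset n → Subset n → Fin n → Fin n → ℚ
  term I J i j = (basis I₀ i₀ I i * g J j) * detWedgeBasis I J (i , j) c
  vanishing : ∀ I J i j → basis I₀ i₀ I i ≡ 0ℚ → term I J i j ≡ 0ℚ
  vanishing I J i j b≡0 = begin
    (basis I₀ i₀ I i * g J j) * D ≡⟨ cong (λ z → (z * g J j) * D) b≡0 ⟩
    (0ℚ * g J j) * D              ≡⟨ cong (_* D) (ℚ.*-zeroˡ (g J j)) ⟩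
    0ℚ * D                        ≡⟨ ℚ.*-zeroˡ D ⟩
    0ℚ                            ∎
    where D = detWedgeBasis I J (i , j) c

∑-comulCoeff : ∀ {n} (K : Subset n) (h : Subset n → Fin n → ℚ) →
  (∑[ allSubsets n ] λ J → ∑[ allFin n ] λ j → comulCoeff K J j * h J j)
    ≡ ∑[ allFin n ] λ j → comulCoeff K (remove K j) j * h (remove K j) j
∑-comulCoeff {n} K h =
  trans (∑-swap (allSubsets n) (allFin n) (λ J j → comulCoeff K J j * h J j))
        (∑-cong (allFin n) λ j → ∑-allSubsets-single (remove K j) λ J J≢ →
           trans (cong (_* h J j) (comulCoeff-≢ K J j J≢)) (ℚ.*-zeroˡ (h J j)))

transposeE : ∀ {n} → Entry n → Entry n
transposeE (i , j) = j , i

transposeC : ∀ {n} → Coord n → Coord n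
transposeC (I′ , J′ , p , q) = J′ , I′ , transposeE p , transposeE q

_ᵀ : ∀ {n} → Dom n → Dom n
(x ᵀ) (I , J , e) = x (J , I , transposeE e)

ᵀ-S21A⊗ΛB : ∀ {n k} {x : Dom n} → InS21A⊗ΛB k x → InΛA⊗S21B k (x ᵀ)
ᵀ-S21A⊗ΛB (deg , ker , w , im) =
  (λ I J e ne → swap (deg J I (transposeE e) ne)) ,
  (w , λ I J i j → im J I j i) ,
  (λ I i K → ker K I i)

=E-transpose : ∀ {n} (e e′ : Entry n) → (transposeE e =E transposeE e′) ≡ (e =E e′)
=E-transpose (i , j) (i′ , j′) = ∧-comm (j =F j′) (i =F i′)

∧-swap-pairs : ∀ a b c d → (a ∧ b ∧ c ∧ d) ≡ (b ∧ a ∧ d ∧ c)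
∧-swap-pairs true  true  c d = ∧-comm c d
∧-swap-pairs true  false c d = refl
∧-swap-pairs false true  c d = refl
∧-swap-pairs false false c d = refl

module _ {n : ℕ} {p q : Entry n} (ord : (transposeE p <E transposeE q) ≡ (p <E q)) where

  wedgeCoeff-transpose : (x y : Entry n) →
    wedgeCoeff (transposeE x) (transposeE y) (transposeE p) (transposeE q) ≡ wedgeCoeff x y p q
  wedgeCoeff-transpose x y = cong₂ (λ a w → [ a ] * w) ord
    (cong₂ (λ s t → [ s ] + - [ t ])
      (cong₂ _∧_ (=E-transpose x p) (=E-transpose y q))
      (cong₂ _∧_ (=E-transpose x q) (=E-transpose y p)))

  detWedgeBasis-transpose : (I J I′ J′ : Subset n) (v : Entry n) →
    detWedgeBasis J I (transposeE v) (transposeC (I′ , J′ , p , q)) ≡ detWedgeBasis I J v (I′ , J′ , p , q)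
  detWedgeBasis-transpose I J I′ J′ v =
    trans (∑-swap (allFin n) (allFin n) λ a b →
             cofactorCoeff J I J′ I′ (a , b) * wedgeCoeff (a , b) (transposeE v) (transposeE p) (transposeE q))
          (∑-cong (allFin n) λ b → ∑-cong (allFin n) λ a → cong₂ _*_
             (cong₂ _*_ (cong [_] (∧-swap-pairs (a ∈ᵇ J) (b ∈ᵇ I) (J′ =S remove J a) (I′ =S remove I b)))
                        (ℚ.*-comm (sgn (#below J a)) (sgn (#below I b))))
             (wedgeCoeff-transpose (b , a) v))

  detWedge-transpose : (x : Dom n) (I′ J′ : Subset n) →
    detWedge (x ᵀ) (transposeC (I′ , J′ , p , q)) ≡ detWedge x (I′ , J′ , p , q)
  detWedge-transpose x I′ J′ = begin
    detWedge (x ᵀ) (transposeC c)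
      ≡⟨ ∑-cong (allSubsets n) (λ I → ∑-cong (allSubsets n) λ J → ∑-cong (allFin n) λ i →
           ∑-cong (allFin n) λ j → cong (x (J , I , (j , i)) *_) (detWedgeBasis-transpose J I I′ J′ (j , i))) ⟩
    (∑[ allSubsets n ] λ I → ∑[ allSubsets n ] λ J → ∑[ allFin n ] λ i → ∑[ allFin n ] λ j → term J I j i)
      ≡⟨ ∑-swap (allSubsets n) (allSubsets n) (λ I J → ∑[ allFin n ] λ i → ∑[ allFin n ] λ j → term J I j i) ⟩
    (∑[ allSubsets n ] λ J → ∑[ allSubsets n ] λ I → ∑[ allFin n ] λ i → ∑[ allFin n ] λ j → term J I j i)
      ≡⟨ ∑-cong (allSubsets n) (λ J → ∑-cong (allSubsets n) λ I →
           ∑-swap (allFin n) (allFin n) (λ i j → term J I j i)) ⟩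
    detWedge x c ∎
    where
    c : Coord n
    c = I′ , J′ , p , q
    term : Subset n → Subset n → Fin n → Fin n → ℚ
    term I J i j = x (I , J , (i , j)) * detWedgeBasis I J (i , j) c

sgn± : ∀ t → (sgn t ≡ 1ℚ) ⊎ (sgn t ≡ - 1ℚ)
sgn± zero    = inj₁ refl
sgn± (suc t) with sgn± t
... | inj₁ s≡1  = inj₂ (cong -_ s≡1)
... | inj₂ s≡-1 = inj₁ (cong -_ s≡-1)

signed-pair-nonzero : ∀ t → (- sgn t) * (- 1ℚ) + (sgn t * 1ℚ + 0ℚ) ≢ 0ℚ
signed-pair-nonzero t with sgn t | sgn± t
... | _ | inj₁ refl = λ ()
... | _ | inj₂ refl = λ ()

DetWedgeNonZeroOn : ∀ {n} → (ℕ → Dom n → Set) → ℕ → Set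
DetWedgeNonZeroOn {n} InSubmodule k = Σ[ x ∈ Dom n ] (InSubmodule k x × NonZeroCod (detWedge x))

module _ {m : ℕ} (F : Subset m) where

  private
    I₀ K₀ R₀ R₁ L : Subset (suc (suc m))
    I₀ = inside ∷ outside ∷ F
    K₀ = inside ∷ inside ∷ F
    R₀ = remove K₀ zero
    R₁ = remove K₀ (suc zero)
    L  = outside ∷ outside ∷ F

    X₀₀ X₀₁ : Entry (suc (suc m))
    X₀₀ = zero , zero
    X₀₁ = zero , suc zero

    x₀ : Dom (suc (suc m))
    x₀ = basis I₀ zero ⊠ comulCoeff K₀

    c₀ : Coord (suc (suc m))
    c₀ = L , L , X₀₀ , X₀₁

    s : ℚ
    s = sgn (#above K₀ (suc zero))

    t : Fin (suc (suc m)) → ℚ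
    t j = comulCoeff K₀ (remove K₀ j) j * detWedgeBasis I₀ (remove K₀ j) (zero , j) c₀

  x₀∈S21A⊗ΛB : InS21A⊗ΛB (suc ∣ F ∣) x₀
  x₀∈S21A⊗ΛB =
    ⊠-hasDegree (suc ∣ F ∣) (basis I₀ zero) (comulCoeff K₀)
      (λ I i ne → cong ∣_∣ (proj₁ (basis-support I₀ zero {I} {i} ne)))
      (λ J j ne → ℕ.suc-injective (comulCoeff-degree K₀ J j ne)) ,
    ⊠-inKerMulA (basis I₀ zero) (comulCoeff K₀) zero∈ ,
    ⊠comulCoeff-inImComulB (basis I₀ zero) K₀
    where
    zero∈ : ∀ I i → basis I₀ zero I i ≢ 0ℚ → i ∈ᵇ I ≡ true
    zero∈ I i ne with basis-support I₀ zero {I} {i} ne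
    ... | refl , refl = refl

  cofactor-term-zero : detWedgeBasis I₀ R₀ X₀₀ c₀ ≡ - 1ℚ
  cofactor-term-zero = begin
    detWedgeBasis I₀ R₀ X₀₀ c₀
      ≡⟨ detWedgeBasis-left I₀ R₀ L L X₀₀ X₀₁ refl ⟩
    - cofactorCoeff I₀ R₀ L L X₀₁
      ≡⟨ cong -_ (cofactorCoeff-remove I₀ R₀ zero (suc zero) refl refl) ⟩
    - cofSign I₀ R₀ X₀₁
      ≡⟨ cong -_ (cong₂ (λ a b → sgn a * sgn b) (#below-zero I₀) (#below-outside-one (inside ∷ F))) ⟩
    - 1ℚ ∎

  cofactor-term-one : detWedgeBasis I₀ R₁ X₀₁ c₀ ≡ 1ℚ
  cofactor-term-one = begin
    detWedgeBasis I₀ R₁ X₀₁ c₀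
      ≡⟨ detWedgeBasis-right I₀ R₁ L L X₀₀ X₀₁ refl ⟩
    cofactorCoeff I₀ R₁ L L X₀₀
      ≡⟨ cofactorCoeff-remove I₀ R₁ zero zero refl refl ⟩
    cofSign I₀ R₁ X₀₀
      ≡⟨ cong₂ (λ a b → sgn a * sgn b) (#below-zero I₀) (#below-zero R₁) ⟩
    1ℚ ∎

  t-zero : t zero ≡ (- s) * (- 1ℚ)
  t-zero = cong₂ _*_
    (trans (comulCoeff-remove K₀ zero refl) (cong sgn (#above-inside-zero F)))
    cofactor-term-zero

  t-one : t (suc zero) ≡ s * 1ℚ
  t-one = cong₂ _*_ (comulCoeff-remove K₀ (suc zero) refl) cofactor-term-one

  t-rest : ∑[ tabulate (λ j → suc (suc j)) ] t ≡ 0ℚ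
  t-rest = trans (∑-tabulate m (λ j → suc (suc j)) t) (∑-zero (allFin m) λ j →
    let j′ = suc (suc j) in
    trans (cong (comulCoeff K₀ (remove K₀ j′) j′ *_)
                (detWedgeBasis-other I₀ (remove K₀ j′) L L (zero , j′) X₀₀ X₀₁ refl refl))
          (ℚ.*-zeroʳ (comulCoeff K₀ (remove K₀ j′) j′)))

  detWedge-x₀ : detWedge x₀ c₀ ≡ (- s) * (- 1ℚ) + (s * 1ℚ + 0ℚ)
  detWedge-x₀ = begin
    detWedge x₀ c₀
      ≡⟨ detWedge-basis⊠ I₀ zero (comulCoeff K₀) c₀ ⟩
    (∑[ allSubsets _ ] λ J → ∑[ allFin _ ] λ j → comulCoeff K₀ J j * detWedgeBasis I₀ J (zero , j) c₀)
      ≡⟨ ∑-comulCoeff K₀ (λ J j → detWedgeBasis I₀ J (zero , j) c₀) ⟩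
    t zero + (t (suc zero) + ∑[ tabulate (λ j → suc (suc j)) ] t)
      ≡⟨ cong₂ (λ a b → a + (b + ∑[ tabulate (λ j → suc (suc j)) ] t)) t-zero t-one ⟩
    (- s) * (- 1ℚ) + (s * 1ℚ + ∑[ tabulate (λ j → suc (suc j)) ] t)
      ≡⟨ cong (λ r → (- s) * (- 1ℚ) + (s * 1ℚ + r)) t-rest ⟩
    (- s) * (- 1ℚ) + (s * 1ℚ + 0ℚ) ∎

  detWedge-x₀≢0 : detWedge x₀ c₀ ≢ 0ℚ
  detWedge-x₀≢0 = signed-pair-nonzero (#above K₀ (suc zero)) ∘ trans (sym detWedge-x₀)

  detWedge-nonzero-on-both :
    DetWedgeNonZeroOn InS21A⊗ΛB (suc ∣ F ∣) × DetWedgeNonZeroOn InΛA⊗S21B (suc ∣ F ∣)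
  detWedge-nonzero-on-both =
    (x₀ , x₀∈S21A⊗ΛB , c₀ , detWedge-x₀≢0) ,
    (x₀ ᵀ , ᵀ-S21A⊗ΛB x₀∈S21A⊗ΛB , transposeC c₀ ,
      detWedge-x₀≢0 ∘ trans (sym (detWedge-transpose {p = X₀₀} {q = X₀₁} refl x₀ L L)))

mainTheorem7 : (n d : ℕ) → 2 ≤ n → 1 ≤ d → d ≤ n ∸ 1 →
    (Σ[ x ∈ Dom n ] (InS21A⊗ΛB (n ∸ d) x × NonZeroCod (detWedge x)))
    × (Σ[ x ∈ Dom n ] (InΛA⊗S21B (n ∸ d) x × NonZeroCod (detWedge x)))
mainTheorem7 (suc (suc m)) (suc d) (s≤s (s≤s _)) (s≤s _) (s≤s d≤m) =
  subst (λ k → DetWedgeNonZeroOn {suc (suc m)} InS21A⊗ΛB k × DetWedgeNonZeroOn {suc (suc m)} InΛA⊗S21B k)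
        k≡n∸d (detWedge-nonzero-on-both F)
  where
  F : Subset m
  F = initialSegment m (m ∸ d)
  k≡n∸d : suc ∣ F ∣ ≡ suc m ∸ d
  k≡n∸d = trans (cong suc (∣initialSegment∣ (ℕ.m∸n≤m m d))) (sym (ℕ.+-∸-assoc 1 d≤m))
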